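{- Let $Q$ be an HDA and let $\pi,\varrho$ be homotopic rooted paths in $Q$. Then $S_\pi=S_\varrho$ and $T_\pi=T_\varrho$.
   Context: Precubical sets: families of disjoint sets $Q_n$ with face maps $s_k,t_k:Q_n\to Q_{n-1}$ ($k=1,\dots,n$) satisfying $\alpha_k\beta_\ell=\beta_{\ell-1}\alpha_k$ for $\alpha,\beta\in\{s,t\}$, $k<\ell$. An HDA is a finite precubical set with initial cell $I\in Q_0$. A step is $q'\xrightarrow{s_i}q$ with $s_iq=q'$, or $q\xrightarrow{t_i}q'$ with $t_iq=q'$; a path is a sequence of consecutive steps; rooted paths start at $I$. Two paths are elementarily homotopic if one is obtained from the other by replacing, for some cells and some $i<j$, a segment $\xrightarrow{s_i}q\xrightarrow{s_j}$ by $\xrightarrow{s_{j-1}}q'\xrightarrow{s_i}$, or a segment $\xrightarrow{t_j}q\xrightarrow{t_i}$ by $\xrightarrow{t_i}q'\xrightarrow{t_{j-1}}$, or a segment $\xrightarrow{s_i}q\xrightarrow{t_j}$ by $\xrightarrow{t_{j-1}}q'\xrightarrow{s_i}$, or a segment $\xrightarrow{s_j}q\xrightarrow{t_i}$ by $\xrightarrow{t_i}q'\xrightarrow{s_{j-1}}$ (the cells before and after the segment being unchanged); homotopy is the equivalence relation generated by elementary homotopy. Universal labels: $\approx$ is the equivalence on $Q_1$ generated by $(s_iq,t_iq)$, $q\in Q_2$, $i\in\{1,2\}$; $\lambda(e)$ the class of $e$; $\lambda_i(q)=\lambda(s_1\cdots s_{i-1}s_{i+1}\cdots s_n(q))$ for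 $q\in Q_n$. For a rooted path $\pi$: the trivial path at $I$ gives $(S,T)=(\emptyset,\emptyset)$; $\pi=\pi'\xrightarrow{s_i}q$ gives $S_\pi=S_{\pi'}\cup\{\lambda_i(q)\}$, $T_\pi=T_{\pi'}$; $\pi=\pi'\xrightarrow{t_i}t_i(q')$ with $q'$ the end of $\pi'$ gives $S_\pi=S_{\pi'}$, $T_\pi=T_{\pi'}\cup\{\lambda_i(q')\}$. -}

module Defs where

open import Data.Nat as ℕ using (ℕ; zero; suc)
open import Data.Fin as Fin using (Fin; zero; suc; toℕ; fromℕ; inject₁; lower₁)
open import Data.Bool using (Bool; false; true)
open import Data.Product using (Σ; _,_; ∃; _×_)
open import Data.Sum using (_⊎_)
open import Data.Empty using (⊥)
open import Relation.Nullary using (yes; no)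
open import Relation.Binary.PropositionalEquality using (_≡_; sym)
open import Relation.Binary.Construct.Closure.Equivalence using (EqClosure)

-- Cells of dimension n are Fin (cells n) (so the
-- families Q_n are automatically disjoint and finite); only finitely many
-- dimensions are inhabited.
-- Face maps are 0-based: ∂ α n k : Q_{n+1} → Q_n for k : Fin (suc n),
-- where k stands for the paper's index k+1.  ∂ false = s, ∂ true = t.
record PrecubicalSet : Set where
  field
    cells   : ℕ → ℕ
    dim     : ℕ
    bounded : ∀ n → dim ℕ.< n → cells n ≡ 0
  Cell : ℕ → Set
  Cell n = Fin (cells n)
  field
    ∂ : Bool → (n : ℕ) → Fin (suc n) → Cell (suc n) → Cell n
    -- α_k β_ℓ = β_{ℓ-1} α_k for k < ℓ (0-based: k ≤ l, ℓ = suc l)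
    precubical : ∀ (α β : Bool) (n : ℕ) (k l : Fin (suc n)) → k Fin.≤ l →
      ∀ (x : Cell (suc (suc n))) →
      ∂ α n k (∂ β (suc n) (suc l) x) ≡ ∂ β n l (∂ α (suc n) (inject₁ k) x)

record HDA : Set where
  field
    Q : PrecubicalSet
  open PrecubicalSet Q public
  field
    I : Cell 0

module HDADefs (H : HDA) where
  open HDA H

  s t : (n : ℕ) → Fin (suc n) → Cell (suc n) → Cell n
  s = ∂ false
  t = ∂ true

  Cell' : Set
  Cell' = Σ ℕ Cell

  data Step : Cell' → Cell' → Set where
    up   : ∀ {n} (i : Fin (suc n)) (q : Cell (suc n)) {q' : Cell n} →
           s n i q ≡ q' → Step (n , q') (suc n , q)
    down : ∀ {n} (i : Fin (suc n)) (q : Cell (suc n)) {q' : Cell n} →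
           t n i q ≡ q' → Step (suc n , q) (n , q')

  infixl 5 _▷_
  data Path : Cell' → Cell' → Set where
    nil : ∀ {x} → Path x x
    _▷_ : ∀ {x y z} → Path x y → Step y z → Path x z

  infixl 4 _++_
  _++_ : ∀ {x y z} → Path x y → Path y z → Path x z
  p ++ nil     = p
  p ++ (r ▷ e) = (p ++ r) ▷ e

  RootedPath : Cell' → Set
  RootedPath y = Path (0 , I) y

  -- the four elementary swaps of a two-step segment (0-based indices;
  -- paper's i < j corresponds to i ≤ l with j = suc l)
  data Swap : ∀ {a b b' c : Cell'} → Step a b → Step b c → Step a b' → Step b' c → Set where
    ss : ∀ {n} {i l : Fin (suc n)} → i Fin.≤ l →
         ∀ {a q c q'} {e₁ e₂ f₁ f₂} →
         Swap (up {n} i q {a} e₁) (up {suc n} (suc l) c {q} e₂)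
              (up {n} l q' {a} f₁) (up {suc n} (inject₁ i) c {q'} f₂)
    tt : ∀ {n} {i l : Fin (suc n)} → i Fin.≤ l →
         ∀ {a q c q'} {e₁ e₂ f₁ f₂} →
         Swap (down {suc n} (suc l) a {q} e₁) (down {n} i q {c} e₂)
              (down {suc n} (inject₁ i) a {q'} f₁) (down {n} l q' {c} f₂)
    st : ∀ {n} {i l : Fin (suc n)} → i Fin.≤ l →
         ∀ {a q c q'} {e₁ e₂ f₁ f₂} →
         Swap (up {suc n} (inject₁ i) q {a} e₁) (down {suc n} (suc l) q {c} e₂)
              (down {n} l a {q'} f₁) (up {n} i c {q'} f₂)
    ts : ∀ {n} {i l : Fin (suc n)} → i Fin.≤ l →
         ∀ {a q c q'} {e₁ e₂ f₁ f₂} →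
         Swap (up {suc n} (suc l) q {a} e₁) (down {suc n} (inject₁ i) q {c} e₂)
              (down {n} i a {q'} f₁) (up {n} l c {q'} f₂)

  data ElemHom {x y : Cell'} : Path x y → Path x y → Set where
    elem : ∀ {a b b' c} (p : Path x a)
           {e₁ : Step a b} {e₂ : Step b c} {f₁ : Step a b'} {f₂ : Step b' c} →
           Swap e₁ e₂ f₁ f₂ → (r : Path c y) →
           ElemHom (p ▷ e₁ ▷ e₂ ++ r) (p ▷ f₁ ▷ f₂ ++ r)

  Homotopic : ∀ {x y} → Path x y → Path x y → Set
  Homotopic = EqClosure ElemHom

  data LabelGen : Cell 1 → Cell 1 → Set where
    gen : ∀ (q : Cell 2) (i : Fin 2) → LabelGen (s 1 i q) (t 1 i q)

  _≈_ : Cell 1 → Cell 1 → Set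
  _≈_ = EqClosure LabelGen

  skipTop : (m : ℕ) → Cell (suc m) → Cell 1
  skipTop zero     q = q
  skipTop (suc m') q = skipTop m' (s (suc m') (inject₁ (fromℕ m')) q)

  -- edge representative of λ_i(q) = λ(s_1⋯s_{i-1}s_{i+1}⋯s_n q), q ∈ Q_{m+1}
  -- (0-based i); faces applied right-to-left: s_n first, ..., s_1 last
  edge : (m : ℕ) → Fin (suc m) → Cell (suc m) → Cell 1
  edge zero     i q = q
  edge (suc m') i q with toℕ i ℕ.≟ suc m'
  ... | yes _ = skipTop (suc m') q
  ... | no ne = edge m' (lower₁ i (λ eq → ne (sym eq))) (s (suc m') (fromℕ (suc m')) q)

  -- S_π and T_π as sets of labels, represented by ≈-closed predicates on Q_1:
  -- S π e  means  λ(e) ∈ S_π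
  S : ∀ {x y} → Path x y → Cell 1 → Set
  S nil e = ⊥
  S (p ▷ up {m} i q _) e = S p e ⊎ (e ≈ edge m i q)
  S (p ▷ down _ _ _) e = S p e

  T : ∀ {x y} → Path x y → Cell 1 → Set
  T nil e = ⊥
  T (p ▷ up _ _ _) e = T p e
  T (p ▷ down {m} i q _) e = T p e ⊎ (e ≈ edge m i q)

module Submission where

-- The heart of the argument is the face-label lemma: for a cell c and any
-- face ∂^α_j c, the universal label of direction i of the face equals the
-- label of the corresponding direction punchIn j i of c.  Since 'edge'
-- computes labels by repeatedly taking lower faces in a fixed order, this is
-- proved by induction on the dimension: a reduction step commutes the face
-- ∂^α_j past the first lower face used by 'edge' (one precubical identity),
-- landing in the same problem one dimension down; in dimension 2 the two
-- faces of a square are ≈ by the very definition of ≈.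
--
-- Specialised to the index patterns of the four elementary swaps, the
-- face-label lemma shows that each swap adjoins the same labels to S and T
-- (possibly in the other order).  Label sets of a path depend on a prefix only
-- through its label sets, so elementary homotopies preserve them, and the
-- equivalence closure (homotopy) does too.

open import Defs
open import Data.Nat as ℕ using (ℕ; zero; suc; s≤s)
open import Data.Fin as Fin using (Fin; zero; suc; toℕ; fromℕ; inject₁; punchIn)
open import Data.Fin.Properties
  using (≤fromℕ; toℕ-fromℕ; toℕ-inject₁; toℕ-inject₁-≢; lower₁-inject₁′; ≤-refl)
open import Data.Bool using (false; true)
open import Data.Product using (_×_; _,_)
open import Data.Sum using (_⊎_; inj₁; inj₂)
open import Function.Base using (_on_)
open import Function.Bundles using (_⇔_; mk⇔)
open import Function.Properties.Equivalence using (⇔-isEquivalence)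
open import Data.Sum.Function.Propositional using (_⊎-⇔_)
open import Relation.Nullary using (yes; no; contradiction)
open import Relation.Binary.Structures using (IsEquivalence)
open import Relation.Binary.PropositionalEquality
  using (_≡_; refl; sym; trans; cong; subst; subst₂; module ≡-Reasoning)
open import Relation.Binary.Construct.Closure.ReflexiveTransitive using (ε; _◅_)
open import Relation.Binary.Construct.Closure.Symmetric using (bwd)
import Relation.Binary.Construct.Closure.Equivalence as EqClosure
import Relation.Binary.Construct.On as On
import Relation.Binary.Construct.Intersection as Intersection

data Position {n : ℕ} : Fin (suc n) → Set where
  below : (k : Fin n) → Position (inject₁ k)
  top   : Position (fromℕ n)

position : ∀ {n} (k : Fin (suc n)) → Position k
position {zero}  zero    = top
position {suc n} zero    = below zero
position {suc n} (suc k) with position k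
... | below k′ = below (suc k′)
... | top      = top

inject₁-mono-≤ : ∀ {n} {i j : Fin n} → i Fin.≤ j → inject₁ i Fin.≤ inject₁ j
inject₁-mono-≤ {i = i} {j} = subst₂ ℕ._≤_ (sym (toℕ-inject₁ i)) (sym (toℕ-inject₁ j))

punchIn-below : ∀ {n} {i l : Fin (suc n)} → i Fin.≤ l → punchIn (suc l) i ≡ inject₁ i
punchIn-below {i = zero}                _         = refl
punchIn-below {suc n} {suc i} {suc l} (s≤s i≤l) = cong suc (punchIn-below i≤l)

punchIn-above : ∀ {n} {i l : Fin (suc n)} → i Fin.≤ l → punchIn (inject₁ i) l ≡ suc l
punchIn-above {i = zero}                _         = refl
punchIn-above {suc n} {suc i} {suc l} (s≤s i≤l) = cong suc (punchIn-above i≤l)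

punchIn-inject₁ : ∀ {n} (j : Fin (suc n)) (i : Fin n) →
                  punchIn (inject₁ j) (inject₁ i) ≡ inject₁ (punchIn j i)
punchIn-inject₁ zero    i       = refl
punchIn-inject₁ (suc j) zero    = refl
punchIn-inject₁ (suc j) (suc i) = cong suc (punchIn-inject₁ j i)

module LabelInvariance (H : HDA) where
  open HDA H
  open HDADefs H
  open IsEquivalence (EqClosure.isEquivalence LabelGen)
    renaming (refl to ≈-refl; sym to ≈-sym; trans to ≈-trans)

  edge-fromℕ≡skipTop : ∀ m (x : Cell (suc m)) → edge m (fromℕ m) x ≡ skipTop m x
  edge-fromℕ≡skipTop zero    x = refl
  edge-fromℕ≡skipTop (suc m) x with toℕ (fromℕ (suc m)) ℕ.≟ suc m
  ... | yes _ = refl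
  ... | no ne = contradiction (toℕ-fromℕ (suc m)) ne

  edge-inject₁ : ∀ m (i : Fin (suc m)) (x : Cell (suc (suc m))) →
                 edge (suc m) (inject₁ i) x ≡ edge m i (s (suc m) (fromℕ (suc m)) x)
  edge-inject₁ m i x with toℕ (inject₁ i) ℕ.≟ suc m
  ... | yes eq = contradiction (sym eq) (toℕ-inject₁-≢ i)
  ... | no ne  = cong (λ k → edge m k _) (lower₁-inject₁′ i _)

  edge-fromℕ : ∀ m (x : Cell (suc (suc m))) →
               edge (suc m) (fromℕ (suc m)) x ≡ edge m (fromℕ m) (s (suc m) (inject₁ (fromℕ m)) x)
  edge-fromℕ m x = trans (edge-fromℕ≡skipTop (suc m) x) (sym (edge-fromℕ≡skipTop m _))

  edge-dir : ∀ {n} {k k′ : Fin (suc n)} (x : Cell (suc n)) → k ≡ k′ → edge n k x ≡ edge n k′ x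
  edge-dir x = cong (λ k → edge _ k x)

  square-face : ∀ (c : Cell 2) (j : Fin 2) α → ∂ α 1 j c ≈ s 1 j c
  square-face c j false = ≈-refl
  square-face c j true  = bwd (gen c j) ◅ ε

  -- A reduction of the face-label problem for (c, j, i) one dimension down:
  -- a smaller cell with a face and a direction such that the face's label
  -- (for every α) and the cell's label agree with those of the original.
  record Reduction (m : ℕ) (c : Cell (suc (suc (suc m))))
                   (j : Fin (suc (suc (suc m)))) (i : Fin (suc (suc m))) : Set where
    field
      cell     : Cell (suc (suc m))
      face     : Fin (suc (suc m))
      dir      : Fin (suc m)
      faceEdge : ∀ α → edge (suc m) i (∂ α (suc (suc m)) j c) ≡ edge m dir (∂ α (suc m) face cell)
      cellEdge : edge (suc (suc m)) (punchIn j i) c ≡ edge (suc m) (punchIn face dir) cell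

  -- Every face-label problem of dimension ≥ 3 reduces: unfold 'edge' once and
  -- commute the face ∂^α_j past the lower face used by the unfolding.
  reduction : ∀ m (c : Cell (suc (suc (suc m)))) (j : Fin (suc (suc (suc m)))) (i : Fin (suc (suc m))) →
              Reduction m c j i
  reduction m c j i with position i | position j
  ... | below i₀ | below j₀ = record
    { cell = d ; face = j₀ ; dir = i₀ ; faceEdge = faceEdge ; cellEdge = cellEdge }
    where
    open ≡-Reasoning
    d : Cell (suc (suc m))
    d = s (suc (suc m)) (fromℕ (suc (suc m))) c
    faceEdge : ∀ α → edge (suc m) (inject₁ i₀) (∂ α (suc (suc m)) (inject₁ j₀) c)
                     ≡ edge m i₀ (∂ α (suc m) j₀ d)
    faceEdge α = trans (edge-inject₁ m i₀ _)
      (cong (edge m i₀) (sym (precubical α false (suc m) j₀ (fromℕ (suc m)) (≤fromℕ j₀) c)))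
    cellEdge : edge (suc (suc m)) (punchIn (inject₁ j₀) (inject₁ i₀)) c
               ≡ edge (suc m) (punchIn j₀ i₀) d
    cellEdge = begin
      edge (suc (suc m)) (punchIn (inject₁ j₀) (inject₁ i₀)) c ≡⟨ edge-dir c (punchIn-inject₁ j₀ i₀) ⟩
      edge (suc (suc m)) (inject₁ (punchIn j₀ i₀)) c          ≡⟨ edge-inject₁ (suc m) (punchIn j₀ i₀) c ⟩
      edge (suc m) (punchIn j₀ i₀) d                          ∎
  ... | below i₀ | top = record
    { cell = d ; face = last ; dir = i₀ ; faceEdge = faceEdge ; cellEdge = cellEdge }
    where
    open ≡-Reasoning
    last : Fin (suc (suc m))
    last = fromℕ (suc m)
    d : Cell (suc (suc m))
    d = s (suc (suc m)) (inject₁ last) c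
    faceEdge : ∀ α → edge (suc m) (inject₁ i₀) (∂ α (suc (suc m)) (suc last) c)
                     ≡ edge m i₀ (∂ α (suc m) last d)
    faceEdge α = trans (edge-inject₁ m i₀ _)
      (cong (edge m i₀) (precubical false α (suc m) last last ≤-refl c))
    cellEdge : edge (suc (suc m)) (punchIn (suc last) (inject₁ i₀)) c ≡ edge (suc m) (punchIn last i₀) d
    cellEdge = begin
      edge (suc (suc m)) (punchIn (suc last) (inject₁ i₀)) c
        ≡⟨ edge-dir c (punchIn-below (≤fromℕ (inject₁ i₀))) ⟩
      edge (suc (suc m)) (inject₁ (inject₁ i₀)) c     ≡⟨ edge-inject₁ (suc m) (inject₁ i₀) c ⟩
      edge (suc m) (inject₁ i₀) (s (suc (suc m)) (suc last) c) ≡⟨ faceEdge false ⟩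
      edge m i₀ (s (suc m) last d)                     ≡⟨ edge-inject₁ m i₀ d ⟨
      edge (suc m) (inject₁ i₀) d                      ≡⟨ edge-dir d (punchIn-below (≤fromℕ i₀)) ⟨
      edge (suc m) (punchIn last i₀) d                 ∎
  ... | top | top = record
    { cell = d ; face = last ; dir = fromℕ m ; faceEdge = faceEdge ; cellEdge = cellEdge }
    where
    open ≡-Reasoning
    last penult : Fin (suc (suc m))
    last   = fromℕ (suc m)
    penult = inject₁ (fromℕ m)
    d : Cell (suc (suc m))
    d = s (suc (suc m)) (inject₁ penult) c
    faceEdge : ∀ α → edge (suc m) last (∂ α (suc (suc m)) (suc last) c)
                     ≡ edge m (fromℕ m) (∂ α (suc m) last d)
    faceEdge α = trans (edge-fromℕ m _)
      (cong (edge m (fromℕ m)) (precubical false α (suc m) penult last (≤fromℕ penult) c))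
    cellEdge : edge (suc (suc m)) (punchIn (suc last) last) c ≡ edge (suc m) (punchIn last (fromℕ m)) d
    cellEdge = begin
      edge (suc (suc m)) (punchIn (suc last) last) c
        ≡⟨ edge-dir c (punchIn-below {i = last} ≤-refl) ⟩
      edge (suc (suc m)) (inject₁ last) c              ≡⟨ edge-inject₁ (suc m) last c ⟩
      edge (suc m) last (s (suc (suc m)) (suc last) c) ≡⟨ faceEdge false ⟩
      edge m (fromℕ m) (s (suc m) last d)              ≡⟨ edge-inject₁ m (fromℕ m) d ⟨
      edge (suc m) penult d                            ≡⟨ edge-dir d (punchIn-below {i = fromℕ m} ≤-refl) ⟨
      edge (suc m) (punchIn last (fromℕ m)) d          ∎
  -- the direction is the top one and the face is not: unfold along the
  -- next-to-top direction, distinguishing whether the face is that direction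
  ... | top | below j₀ with position j₀
  ...   | below j₀₀ = record
    { cell = d ; face = inject₁ j₀₀ ; dir = fromℕ m ; faceEdge = faceEdge ; cellEdge = cellEdge }
    where
    open ≡-Reasoning
    penult : Fin (suc (suc m))
    penult = inject₁ (fromℕ m)
    d : Cell (suc (suc m))
    d = s (suc (suc m)) (suc penult) c
    faceEdge : ∀ α → edge (suc m) (fromℕ (suc m)) (∂ α (suc (suc m)) (inject₁ (inject₁ j₀₀)) c)
                     ≡ edge m (fromℕ m) (∂ α (suc m) (inject₁ j₀₀) d)
    faceEdge α = trans (edge-fromℕ m _)
      (cong (edge m (fromℕ m))
            (sym (precubical α false (suc m) (inject₁ j₀₀) penult
                              (inject₁-mono-≤ (≤fromℕ j₀₀)) c)))
    cellEdge : edge (suc (suc m)) (punchIn (inject₁ (inject₁ j₀₀)) (fromℕ (suc m))) c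
               ≡ edge (suc m) (punchIn (inject₁ j₀₀) (fromℕ m)) d
    cellEdge = begin
      edge (suc (suc m)) (punchIn (inject₁ (inject₁ j₀₀)) (fromℕ (suc m))) c
        ≡⟨ edge-dir c (punchIn-above (≤fromℕ (inject₁ j₀₀))) ⟩
      edge (suc (suc m)) (fromℕ (suc (suc m))) c       ≡⟨ edge-fromℕ (suc m) c ⟩
      edge (suc m) (fromℕ (suc m)) d                   ≡⟨ edge-dir d (punchIn-above (≤fromℕ j₀₀)) ⟨
      edge (suc m) (punchIn (inject₁ j₀₀) (fromℕ m)) d ∎
  ...   | top = record
    { cell = d ; face = penult ; dir = fromℕ m ; faceEdge = faceEdge ; cellEdge = cellEdge }
    where
    open ≡-Reasoning
    penult : Fin (suc (suc m))
    penult = inject₁ (fromℕ m)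
    d : Cell (suc (suc m))
    d = s (suc (suc m)) (inject₁ penult) c
    faceEdge : ∀ α → edge (suc m) (fromℕ (suc m)) (∂ α (suc (suc m)) (suc penult) c)
                     ≡ edge m (fromℕ m) (∂ α (suc m) penult d)
    faceEdge α = trans (edge-fromℕ m _)
      (cong (edge m (fromℕ m)) (precubical false α (suc m) penult penult ≤-refl c))
    cellEdge : edge (suc (suc m)) (punchIn (suc penult) (fromℕ (suc m))) c
               ≡ edge (suc m) (punchIn penult (fromℕ m)) d
    cellEdge = begin
      edge (suc (suc m)) (punchIn (suc penult) (fromℕ (suc m))) c
        ≡⟨ edge-dir c (punchIn-above {i = fromℕ (suc m)} ≤-refl) ⟩
      edge (suc (suc m)) (fromℕ (suc (suc m))) c                 ≡⟨ edge-fromℕ (suc m) c ⟩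
      edge (suc m) (fromℕ (suc m)) (s (suc (suc m)) (suc penult) c) ≡⟨ faceEdge false ⟩
      edge m (fromℕ m) (s (suc m) penult d)                      ≡⟨ edge-fromℕ m d ⟨
      edge (suc m) (fromℕ (suc m)) d
        ≡⟨ edge-dir d (punchIn-above {i = fromℕ m} ≤-refl) ⟨
      edge (suc m) (punchIn penult (fromℕ m)) d                  ∎

  face-label : ∀ m (c : Cell (suc (suc m))) (j : Fin (suc (suc m))) (i : Fin (suc m)) α →
               edge m i (∂ α (suc m) j c) ≈ edge (suc m) (punchIn j i) c
  face-label zero    c zero       zero α = square-face c zero α
  face-label zero    c (suc zero) zero α = square-face c (suc zero) α
  face-label (suc m) c j          i    α = begin
      edge (suc m) i (∂ α (suc (suc m)) j c) ≡⟨ faceEdge α ⟩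
      edge m dir (∂ α (suc m) face cell)     ≈⟨ face-label m cell face dir α ⟩
      edge (suc m) (punchIn face dir) cell   ≡⟨ cellEdge ⟨
      edge (suc (suc m)) (punchIn j i) c     ∎
    where
    open Reduction (reduction m c j i)
    open import Relation.Binary.Reasoning.Setoid (EqClosure.setoid LabelGen)

  face-label-below : ∀ {n} {i l : Fin (suc n)} → i Fin.≤ l → ∀ (c : Cell (suc (suc n))) α →
                     edge n i (∂ α (suc n) (suc l) c) ≈ edge (suc n) (inject₁ i) c
  face-label-below {n} {i} {l} i≤l c α =
    subst (λ k → edge n i (∂ α (suc n) (suc l) c) ≈ edge (suc n) k c)
          (punchIn-below i≤l) (face-label n c (suc l) i α)

  face-label-above : ∀ {n} {i l : Fin (suc n)} → i Fin.≤ l → ∀ (c : Cell (suc (suc n))) α →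
                     edge n l (∂ α (suc n) (inject₁ i) c) ≈ edge (suc n) (suc l) c
  face-label-above {n} {i} {l} i≤l c α =
    subst (λ k → edge n l (∂ α (suc n) (inject₁ i) c) ≈ edge (suc n) k c)
          (punchIn-above i≤l) (face-label n c (inject₁ i) l α)

  LabelSet : Set₁
  LabelSet = Cell 1 → Set

  infix 4 _≋_
  _≋_ : LabelSet → LabelSet → Set
  P ≋ Q = ∀ e → P e ⇔ Q e

  ≋-isEquivalence : IsEquivalence _≋_
  ≋-isEquivalence = record
    { refl  = λ _ → ⇔.refl
    ; sym   = λ P≋Q e → ⇔.sym (P≋Q e)
    ; trans = λ P≋Q Q≋R e → ⇔.trans (P≋Q e) (Q≋R e)
    }
    where module ⇔ = IsEquivalence ⇔-isEquivalence

  open IsEquivalence ≋-isEquivalence using () renaming (refl to ≋-refl; trans to ≋-trans)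

  infixl 5 _⊕_
  _⊕_ : LabelSet → Cell 1 → LabelSet
  (P ⊕ x) e = P e ⊎ e ≈ x

  ⊕-cong : ∀ {P Q x y} → P ≋ Q → x ≈ y → P ⊕ x ≋ Q ⊕ y
  ⊕-cong P≋Q x≈y e =
    P≋Q e ⊎-⇔ mk⇔ (λ e≈x → ≈-trans e≈x x≈y) (λ e≈y → ≈-trans e≈y (≈-sym x≈y))

  ⊕-comm : ∀ {P x y} → P ⊕ x ⊕ y ≋ P ⊕ y ⊕ x
  ⊕-comm e = mk⇔ exchange exchange
    where
    exchange : ∀ {A B C : Set} → (A ⊎ B) ⊎ C → (A ⊎ C) ⊎ B
    exchange (inj₁ (inj₁ a)) = inj₁ (inj₁ a)
    exchange (inj₁ (inj₂ b)) = inj₂ b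
    exchange (inj₂ c)        = inj₁ (inj₂ c)

  ⊕-swap : ∀ {P x₁ x₂ y₁ y₂} → x₁ ≈ y₂ → x₂ ≈ y₁ → P ⊕ x₁ ⊕ x₂ ≋ P ⊕ y₁ ⊕ y₂
  ⊕-swap x₁≈y₂ x₂≈y₁ = ≋-trans (⊕-cong (⊕-cong ≋-refl x₁≈y₂) x₂≈y₁) ⊕-comm

  SameLabels : ∀ {x y} → Path x y → Path x y → Set
  SameLabels = (_≋_ on S) Intersection.∩ (_≋_ on T)

  sameLabels-isEquivalence : ∀ {x y} → IsEquivalence (SameLabels {x} {y})
  sameLabels-isEquivalence = Intersection.isEquivalence
    (On.isEquivalence S ≋-isEquivalence) (On.isEquivalence T ≋-isEquivalence)

  append-labels : ∀ {x c} {p p′ : Path x c} → SameLabels p p′ →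
                  ∀ {y} (r : Path c y) → SameLabels (p ++ r) (p′ ++ r)
  append-labels same nil = same
  append-labels same (r ▷ up _ _ _) with append-labels same r
  ... | sameS , sameT = ⊕-cong sameS ≈-refl , sameT
  append-labels same (r ▷ down _ _ _) with append-labels same r
  ... | sameS , sameT = sameS , ⊕-cong sameT ≈-refl

  swap-labels : ∀ {x a b b′ c}
                {e₁ : Step a b} {e₂ : Step b c} {f₁ : Step a b′} {f₂ : Step b′ c} →
                Swap e₁ e₂ f₁ f₂ → (p : Path x a) →
                SameLabels (p ▷ e₁ ▷ e₂) (p ▷ f₁ ▷ f₂)
  swap-labels (ss i≤l {c = c} {e₂ = refl} {f₂ = refl}) p =
    ⊕-swap (face-label-below i≤l c false) (≈-sym (face-label-above i≤l c false)) , ≋-refl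
  swap-labels (tt i≤l {a = a} {e₁ = refl} {f₁ = refl}) p =
    ≋-refl , ⊕-swap (≈-sym (face-label-above i≤l a true)) (face-label-below i≤l a true)
  swap-labels (st i≤l {q = q} {e₁ = refl} {e₂ = refl}) p =
    ⊕-cong ≋-refl (≈-sym (face-label-below i≤l q true)) ,
    ⊕-cong ≋-refl (≈-sym (face-label-above i≤l q false))
  swap-labels (ts i≤l {q = q} {e₁ = refl} {e₂ = refl}) p =
    ⊕-cong ≋-refl (≈-sym (face-label-above i≤l q true)) ,
    ⊕-cong ≋-refl (≈-sym (face-label-below i≤l q false))

  elem-labels : ∀ {x y} {π ϱ : Path x y} → ElemHom π ϱ → SameLabels π ϱ
  elem-labels (elem p swap r) = append-labels (swap-labels swap p) r

  homotopy-labels : ∀ {x y} {π ϱ : Path x y} → Homotopic π ϱ → SameLabels π ϱ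
  homotopy-labels = EqClosure.fold sameLabels-isEquivalence elem-labels

lemma4p7 : (H : HDA) → let open HDADefs H in
    ∀ {y : Cell'} (π ϱ : RootedPath y) → Homotopic π ϱ →
    (∀ e → S π e ⇔ S ϱ e) × (∀ e → T π e ⇔ T ϱ e)
lemma4p7 H π ϱ = LabelInvariance.homotopy-labels H
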